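{- Let $Q$ and $Q'$ be plactic biwords that are connected by the generalized Knuth relations. Then for every integer $i \ge 0$, the biwords $Q_{>i}$ and $Q'_{>i}$ are connected by the generalized Knuth relations.
   Context: A biletter is a pair of positive integers $\binom{a}{k}$ with $a \le k$. A plactic biword is a finite word of biletters $\binom{a_1,\dots,a_\ell}{k_1,\dots,k_\ell}$ (each $\binom{a_j}{k_j}$ a biletter) such that $k_j \ge k_{j+1}$ for every $j$; the empty biword is allowed. The generalized Knuth relations are the following moves on plactic biwords, where "$\cdots$" denotes arbitrary (identical on both sides) prefixes and suffixes: (1) $\binom{\cdots\, b\ a\ c\,\cdots}{\cdots\, k\ k\ k\,\cdots}\sim\binom{\cdots\, b\ c\ a\,\cdots}{\cdots\, k\ k\ k\,\cdots}$ if $a<b\le c$; (2) $\binom{\cdots\, a\ c\ b\,\cdots}{\cdots\, k\ k\ k\,\cdots}\sim\binom{\cdots\, c\ a\ b\,\cdots}{\cdots\, k\ k\ k\,\cdots}$ if $a\le b<c$; (3) $\binom{\cdots\, a\ b\,\cdots}{\cdots\, k\ k\,\cdots}\sim\binom{\cdots\, a\ b\,\cdots}{\cdots\, k+1\ k\,\cdots}$ if $a\le b$; (4) $\binom{\cdots\, b\ a\,\cdots}{\cdots\, k+1\ k+1\,\cdots}\sim\binom{\cdots\, b\ a\,\cdots}{\cdots\, k+1\ k\,\cdots}$ if $a<b$. These relations are only applied when both sides are plactic biwords (in particular relations (3) and (4) are not applied if the result is not plactic). Two plactic biwords are connected by the generalized Knuth relations if one can be transformed into the other by a finite sequence of such moves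 (applied in either direction). For a biword $Q$ and an integer $i\ge 0$, $Q_{>i}$ denotes the biword obtained from $Q$ by deleting every biletter $\binom{a_j}{k_j}$ with $a_j \le i$ (keeping the remaining biletters in their original order); in particular $Q_{>0}=Q$. -}

module Defs where

open import Data.Nat using (ℕ; suc; _≤_; _<_; _≥_; _≤?_; _<?_)
open import Data.Product using (_×_; _,_)
open import Data.List using (List; []; _∷_; _++_; filter)
open import Data.List.Relation.Unary.All using (All)
open import Data.List.Relation.Unary.Linked using (Linked)
open import Relation.Binary.PropositionalEquality using (_≡_)
open import Relation.Binary.Construct.Closure.Equivalence using (EqClosure)


open import Data.Product using (proj₁)

-- A biletter (a over k) is represented by the pair (a , k): top entry a, bottom entry k.
Biletter : Set
Biletter = ℕ × ℕ

IsBiletter : Biletter → Set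
IsBiletter (a , k) = (1 ≤ a) × (a ≤ k)

Biword : Set
Biword = List Biletter

BottomGeq : Biletter → Biletter → Set
BottomGeq (_ , k) (_ , k') = k ≥ k'

Plactic : Biword → Set
Plactic w = All IsBiletter w × Linked BottomGeq w

-- the local moves of the generalized Knuth relations (one direction each;
-- symmetry is supplied by the equivalence closure)
data Move : Biword → Biword → Set where
  knuth1 : ∀ {a b c k} → a < b → b ≤ c →
    Move ((b , k) ∷ (a , k) ∷ (c , k) ∷ []) ((b , k) ∷ (c , k) ∷ (a , k) ∷ [])
  knuth2 : ∀ {a b c k} → a ≤ b → b < c →
    Move ((a , k) ∷ (c , k) ∷ (b , k) ∷ []) ((c , k) ∷ (a , k) ∷ (b , k) ∷ [])
  knuth3 : ∀ {a b k} → a ≤ b →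
    Move ((a , k) ∷ (b , k) ∷ []) ((a , suc k) ∷ (b , k) ∷ [])
  knuth4 : ∀ {a b k} → a < b →
    Move ((b , suc k) ∷ (a , suc k) ∷ []) ((b , suc k) ∷ (a , k) ∷ [])

data Step : Biword → Biword → Set where
  step : ∀ {u v} (pre suf : Biword) → Move u v →
    Plactic (pre ++ u ++ suf) → Plactic (pre ++ v ++ suf) →
    Step (pre ++ u ++ suf) (pre ++ v ++ suf)

KnuthConnected : Biword → Biword → Set
KnuthConnected = EqClosure Step

_>ᵢ_ : Biword → ℕ → Biword
Q >ᵢ i = filter (λ l → i <? proj₁ l) Q

{-# OPTIONS --safe #-}
-- A move involves two or three letters, and the smallest top entry among them
-- belongs to a letter that the move relocates or rebottoms, all other tops being
-- at least as large.  So deleting the letters with top ≤ i either keeps every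
-- letter of the move, and the same move applies inside Q_{>i} (subwords of plactic
-- biwords are plactic), or deletes that letter, after which both sides of the move
-- become the same word.
module Submission where

open import Defs
open import Data.Nat using (ℕ; suc; _<_; _<?_)
open import Data.Nat.Properties using (≤-trans; <-trans; <-≤-trans)
open import Data.Product using (_×_; _,_; proj₁)
open import Data.Sum using (_⊎_; inj₁; inj₂)
open import Data.List using ([]; _∷_; _++_)
open import Data.List.Properties using (filter-++; filter-all; filter-reject)
open import Data.List.Relation.Unary.All using (All; []; _∷_)
import Data.List.Relation.Unary.All.Properties as All
import Data.List.Relation.Unary.Linked.Properties as Linked
open import Relation.Nullary using (¬_; yes; no)
open import Relation.Unary using (Decidable)
open import Relation.Binary.PropositionalEquality
  using (_≡_; sym; trans; cong; subst; subst₂; module ≡-Reasoning)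
open import Relation.Binary.Construct.Closure.Equivalence
  using (gfold; return; reflexive; isEquivalence)

BottomGeq-trans : ∀ {x y z} → BottomGeq x y → BottomGeq y z → BottomGeq x z
BottomGeq-trans x≥y y≥z = ≤-trans y≥z x≥y

module _ (i : ℕ) where

  Kept : Biletter → Set
  Kept l = i < proj₁ l

  kept? : Decidable Kept
  kept? l = i <? proj₁ l

  Plactic->ᵢ : ∀ {w} → Plactic w → Plactic (w >ᵢ i)
  Plactic->ᵢ (letters , bottoms) =
    All.filter⁺ kept? letters , Linked.filter⁺ kept? (λ {x y z} → BottomGeq-trans {x} {y} {z}) bottoms

  >ᵢ-infix : ∀ pre u suf → (pre ++ u ++ suf) >ᵢ i ≡ pre >ᵢ i ++ u >ᵢ i ++ suf >ᵢ i
  >ᵢ-infix pre u suf =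
    trans (filter-++ kept? pre (u ++ suf)) (cong (pre >ᵢ i ++_) (filter-++ kept? u suf))

  >ᵢ-delete : ∀ pre {l} suf → ¬ Kept l → (pre ++ l ∷ suf) >ᵢ i ≡ (pre ++ suf) >ᵢ i
  >ᵢ-delete pre {l} suf l-dropped = begin
    (pre ++ l ∷ suf) >ᵢ i      ≡⟨ filter-++ kept? pre (l ∷ suf) ⟩
    pre >ᵢ i ++ (l ∷ suf) >ᵢ i ≡⟨ cong (pre >ᵢ i ++_) (filter-reject kept? l-dropped) ⟩
    pre >ᵢ i ++ suf >ᵢ i       ≡⟨ filter-++ kept? pre suf ⟨
    (pre ++ suf) >ᵢ i          ∎
    where open ≡-Reasoning

  Move-kept⊎collapses : ∀ {u v} → Move u v → (All Kept u × All Kept v) ⊎ (u >ᵢ i ≡ v >ᵢ i)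
  Move-kept⊎collapses (knuth1 {a} {b} {c} {k} a<b b≤c) with i <? a
  ... | yes i<a = inj₁ ((i<b ∷ i<a ∷ i<c ∷ []) , (i<b ∷ i<c ∷ i<a ∷ []))
    where i<b = <-trans i<a a<b
          i<c = <-≤-trans i<b b≤c
  ... | no i≮a = inj₂ (trans (>ᵢ-delete ((b , k) ∷ []) ((c , k) ∷ []) i≮a)
                             (sym (>ᵢ-delete ((b , k) ∷ (c , k) ∷ []) [] i≮a)))
  Move-kept⊎collapses (knuth2 {a} {b} {c} {k} a≤b b<c) with i <? a
  ... | yes i<a = inj₁ ((i<a ∷ i<c ∷ i<b ∷ []) , (i<c ∷ i<a ∷ i<b ∷ []))
    where i<b = <-≤-trans i<a a≤b
          i<c = <-trans i<b b<c
  ... | no i≮a = inj₂ (trans (>ᵢ-delete [] ((c , k) ∷ (b , k) ∷ []) i≮a)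
                             (sym (>ᵢ-delete ((c , k) ∷ []) ((b , k) ∷ []) i≮a)))
  Move-kept⊎collapses (knuth3 {a} {b} {k} a≤b) with i <? a
  ... | yes i<a = inj₁ ((i<a ∷ i<b ∷ []) , (i<a ∷ i<b ∷ []))
    where i<b = <-≤-trans i<a a≤b
  ... | no i≮a = inj₂ (trans (>ᵢ-delete [] ((b , k) ∷ []) i≮a)
                             (sym (>ᵢ-delete [] ((b , k) ∷ []) i≮a)))
  Move-kept⊎collapses (knuth4 {a} {b} {k} a<b) with i <? a
  ... | yes i<a = inj₁ ((<-trans i<a a<b ∷ i<a ∷ []) , (<-trans i<a a<b ∷ i<a ∷ []))
  ... | no i≮a = inj₂ (trans (>ᵢ-delete ((b , suc k) ∷ []) [] i≮a)
                             (sym (>ᵢ-delete ((b , suc k) ∷ []) [] i≮a)))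

  Step->ᵢ : ∀ {u v} → Step u v → KnuthConnected (u >ᵢ i) (v >ᵢ i)
  Step->ᵢ (step {u} {v} pre suf move pu pv) with Move-kept⊎collapses move
  ... | inj₁ (u-kept , v-kept) =
    subst₂ KnuthConnected (sym (framed u-kept)) (sym (framed v-kept))
      (return (step (pre >ᵢ i) (suf >ᵢ i) move
        (subst Plactic (framed u-kept) (Plactic->ᵢ pu))
        (subst Plactic (framed v-kept) (Plactic->ᵢ pv))))
    where
    framed : ∀ {w} → All Kept w → (pre ++ w ++ suf) >ᵢ i ≡ pre >ᵢ i ++ w ++ suf >ᵢ i
    framed {w} w-kept = trans (>ᵢ-infix pre w suf)
      (cong (λ x → pre >ᵢ i ++ x ++ suf >ᵢ i) (filter-all kept? w-kept))
  ... | inj₂ collapse = subst (KnuthConnected ((pre ++ u ++ suf) >ᵢ i)) same (reflexive Step)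
    where
    open ≡-Reasoning
    same : (pre ++ u ++ suf) >ᵢ i ≡ (pre ++ v ++ suf) >ᵢ i
    same = begin
      (pre ++ u ++ suf) >ᵢ i            ≡⟨ >ᵢ-infix pre u suf ⟩
      pre >ᵢ i ++ u >ᵢ i ++ suf >ᵢ i    ≡⟨ cong (λ x → pre >ᵢ i ++ x ++ suf >ᵢ i) collapse ⟩
      pre >ᵢ i ++ v >ᵢ i ++ suf >ᵢ i    ≡⟨ >ᵢ-infix pre v suf ⟨
      (pre ++ v ++ suf) >ᵢ i            ∎

lemma2p4 : (Q Q' : Biword) → Plactic Q → Plactic Q' → KnuthConnected Q Q' →
    (i : ℕ) → KnuthConnected (Q >ᵢ i) (Q' >ᵢ i)
lemma2p4 Q Q' _ _ Q∼Q' i = gfold (isEquivalence Step) (_>ᵢ i) (Step->ᵢ i) Q∼Q'
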